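{- If $n$ and $a$ are integers with $n=3a-1$ and $a\ge 4$, then $$\beta_b(\overrightarrow{C}(n;1,a)) = \beta_b(\overrightarrow{C}(n;1,-(2a-1))) = \left\lfloor \frac{n}{2}\right\rfloor.$$
   Context: For integers $n\ge 3$ and $b_1,\dots,b_k$, the oriented circulant graph $\overrightarrow{C}(n;b_1,\dots,b_k)$ has vertex set $\{v_0,\dots,v_{n-1}\}$ and arc set $\{v_iv_{i+b_j} : 0\le i\le n-1,\ 1\le j\le k\}$, with subscripts taken modulo $n$ (negative $b_j$ allowed). $d(u,v)$ is the length of a shortest directed path from $u$ to $v$; $e(v)=\max_u d(v,u)$ is the eccentricity; $\mathrm{diam}$ is the maximum eccentricity. An independent broadcast on an oriented graph $\overrightarrow{G}$ is a function $f:V(\overrightarrow{G})\to\{0,\dots,\mathrm{diam}(\overrightarrow{G})\}$ with $f(v)\le e(v)$ for all $v$, and $d(u,v)>f(u)$ for all distinct $u,v$ with $f(u),f(v)>0$. Its cost is $\sigma(f)=\sum_v f(v)$, and $\beta_b(\overrightarrow{G})$ is the maximum cost of an independent broadcast on $\overrightarrow{G}$. -}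

module Defs where

open import Data.Nat as ℕ using (ℕ; zero; suc; _≤_; _<_)
open import Data.Integer as ℤ using (ℤ; +_; _-_)
open import Data.Integer.Divisibility using (_∣_)
open import Data.Fin using (Fin; toℕ)
open import Data.List using (List; tabulate)
open import Data.Nat.ListAction using (sum)
open import Data.List.Relation.Unary.Any using (Any)
open import Data.Product using (Σ; ∃; ∃-syntax; _×_)
open import Relation.Nullary using (¬_)
open import Relation.Binary.PropositionalEquality using (_≡_; _≢_)

-- Oriented circulant graph C(n; b_1,...,b_k): vertices v_0..v_{n-1} (Fin n),
-- arc v_i -> v_j iff j ≡ i + b (mod n) for some generator b in the list.
Arc : (n : ℕ) → List ℤ → Fin n → Fin n → Set
Arc n bs u v = Any (λ b → (+ n) ∣ ((+ toℕ v) - ((+ toℕ u) ℤ.+ b))) bs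

data Walk (n : ℕ) (bs : List ℤ) : ℕ → Fin n → Fin n → Set where
  here : ∀ {u} → Walk n bs zero u u
  step : ∀ {k u v w} → Arc n bs u v → Walk n bs k v w → Walk n bs (suc k) u w

-- d(u,v) = k : k is the length of a shortest directed path (= shortest walk) from u to v.
Dist : (n : ℕ) → List ℤ → Fin n → Fin n → ℕ → Set
Dist n bs u v k = Walk n bs k u v × (∀ j → j < k → ¬ Walk n bs j u v)

-- m ≤ e(v) = max_u d(v,u)
LeEcc : (n : ℕ) → List ℤ → Fin n → ℕ → Set
LeEcc n bs v m = ∃[ u ] ∃[ k ] (Dist n bs v u k × m ≤ k)

-- k ≤ diam = max_v e(v)
LeDiam : (n : ℕ) → List ℤ → ℕ → Set
LeDiam n bs m = ∃[ v ] LeEcc n bs v m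

IndependentBroadcast : (n : ℕ) → List ℤ → (Fin n → ℕ) → Set
IndependentBroadcast n bs f =
  (∀ v → LeDiam n bs (f v)) ×
  (∀ v → LeEcc n bs v (f v)) ×
  (∀ u v → u ≢ v → 0 < f u → 0 < f v → ∀ k → Dist n bs u v k → f u < k)

cost : (n : ℕ) → (Fin n → ℕ) → ℕ
cost n f = sum (tabulate f)

BroadcastIndependenceNumber : (n : ℕ) → List ℤ → ℕ → Set
BroadcastIndependenceNumber n bs m =
  (∃[ f ] (IndependentBroadcast n bs f × cost n f ≡ m)) ×
  (∀ f → IndependentBroadcast n bs f → cost n f ≤ m)

{-# OPTIONS --safe #-}
-- Since 3a ≡ 1 (mod n) and a + (2a − 1) = n, both generator sets give the arcs
-- v → v + 1 and v → v + a, which in the coordinate x = 3v (mod n) become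
-- x → x + 3 and x → x + 1.  A walk of length i + j thus moves the coordinate by
-- 3i + j, and every offset s < 2k is reached by a walk of length at most k.
-- Hence a vertex broadcasting with strength k ≤ e(v) ≤ a ≤ n/2 forces the next
-- 2k − 1 coordinates to be silent; reading the coordinates once around the cycle,
-- starting at a broadcasting vertex, these blocks are disjoint and 2σ(f) ≤ n.
-- Conversely, since 3i + j ≡ i + j (mod 2), strength 1 on the even coordinates
-- (for odd n = 2e + 5: on 0, 2, …, 2e − 2, and strength 2 on 2e) is an independent
-- broadcast of cost ⌊n/2⌋.
module Submission where

open import Defs
open import Data.Nat using (ℕ; _≤_; _*_; _∸_; _/_)
open import Data.Integer using (+_; -_)
open import Data.List using (_∷_; [])
open import Data.Product using (_×_)
open import Relation.Binary.PropositionalEquality using (_≡_)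

open import Data.Nat
  using (zero; suc; pred; _+_; _%_; _<_; z≤n; s≤s; z<s; s<s; NonZero; >-nonZero; ∣_-_∣)
open import Data.Nat.Properties
open import Data.Nat.DivMod
open import Data.Nat.Divisibility using (_∣_; divides; ∣-refl)
open import Data.Nat.Induction using (<-rec)
open import Data.Nat.ListAction using (sum)
open import Data.Integer as ℤ using (ℤ)
import Data.Integer.Properties as ℤ
open import Data.Integer.Divisibility using () renaming (_∣_ to _∣ℤ_)
open import Data.Integer.Tactic.RingSolver using (solve-∀)
open import Data.Fin as Fin using (Fin; toℕ; fromℕ<)
open import Data.Fin.Properties using (toℕ-injective; toℕ<n; toℕ-fromℕ<; any?)
open import Data.Fin.Permutation using (Permutation; permutation)
import Algebra.Properties.CommutativeMonoid.Sum as CommutativeMonoidSum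
open import Data.List using (List; tabulate)
open import Data.List.Relation.Unary.Any using (here; there)
open import Data.Product using (∃₂; ∃-syntax; _,_; proj₁; proj₂)
open import Data.Sum using (_⊎_; inj₁; inj₂; [_,_])
import Data.Sum as Sum
open import Data.Empty using (⊥-elim)
open import Function using (_∘_; _⇔_; mk⇔; Equivalence)
open import Level using (0ℓ)
open import Relation.Binary using (Setoid)
import Relation.Binary.Construct.On as On
import Relation.Binary.Reasoning.Setoid as SetoidReasoning
open import Relation.Nullary using (¬_; yes; no; contradiction)
open import Relation.Binary.PropositionalEquality
  using (_≢_; refl; sym; trans; cong; cong₂; subst; isEquivalence; module ≡-Reasoning)

variable
  d k m r x y x′ y′ : ℕ
  g : ℕ → ℕ

∣[+m]-[+n]∣≡∣m-n∣ : ∀ m n → ℤ.∣ ℤ.+ m ℤ.- ℤ.+ n ∣ ≡ ∣ m - n ∣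
∣[+m]-[+n]∣≡∣m-n∣ m n with ≤-total n m
... | inj₁ n≤m = begin
  ℤ.∣ ℤ.+ m ℤ.- ℤ.+ n ∣ ≡⟨ cong ℤ.∣_∣ (ℤ.[+m]-[+n]≡m⊖n m n) ⟩
  ℤ.∣ m ℤ.⊖ n ∣         ≡⟨ ℤ.∣m⊖n∣≡∣n⊖m∣ m n ⟩
  ℤ.∣ n ℤ.⊖ m ∣         ≡⟨ ℤ.∣⊖∣-≤ n≤m ⟩
  m ∸ n                 ≡⟨ m≤n⇒∣n-m∣≡n∸m n≤m ⟨
  ∣ m - n ∣             ∎
  where open ≡-Reasoning
... | inj₂ m≤n = begin
  ℤ.∣ ℤ.+ m ℤ.- ℤ.+ n ∣ ≡⟨ cong ℤ.∣_∣ (ℤ.[+m]-[+n]≡m⊖n m n) ⟩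
  ℤ.∣ m ℤ.⊖ n ∣         ≡⟨ ℤ.∣⊖∣-≤ m≤n ⟩
  n ∸ m                 ≡⟨ m≤n⇒∣m-n∣≡n∸m m≤n ⟨
  ∣ m - n ∣             ∎
  where open ≡-Reasoning

module Congruence (n : ℕ) .{{_ : NonZero n}} where

  infix 4 _≋_
  _≋_ : ℕ → ℕ → Set
  x ≋ y = x % n ≡ y % n

  ≋-setoid : Setoid 0ℓ 0ℓ
  ≋-setoid = record
    { Carrier = ℕ ; _≈_ = _≋_ ; isEquivalence = On.isEquivalence (_% n) isEquivalence }

  module ≋-Reasoning = SetoidReasoning ≋-setoid

  ≋-reflexive : x ≡ y → x ≋ y
  ≋-reflexive = cong (_% n)

  +-cong-≋ : x ≋ x′ → y ≋ y′ → x + y ≋ x′ + y′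
  +-cong-≋ {x} {x′} {y} {y′} x≋x′ y≋y′ = begin
    (x + y) % n           ≡⟨ %-distribˡ-+ x y n ⟩
    (x % n + y % n) % n   ≡⟨ cong₂ (λ u v → (u + v) % n) x≋x′ y≋y′ ⟩
    (x′ % n + y′ % n) % n ≡⟨ %-distribˡ-+ x′ y′ n ⟨
    (x′ + y′) % n         ∎
    where open ≡-Reasoning

  *-cong-≋ : x ≋ x′ → y ≋ y′ → x * y ≋ x′ * y′
  *-cong-≋ {x} {x′} {y} {y′} x≋x′ y≋y′ = begin
    (x * y) % n             ≡⟨ %-distribˡ-* x y n ⟩
    (x % n * (y % n)) % n   ≡⟨ cong₂ (λ u v → (u * v) % n) x≋x′ y≋y′ ⟩
    (x′ % n * (y′ % n)) % n ≡⟨ %-distribˡ-* x′ y′ n ⟨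
    (x′ * y′) % n           ∎
    where open ≡-Reasoning

  %-≋ : ∀ x → x % n ≋ x
  %-≋ x = m%n%n≡m%n x n

  +n-≋ : ∀ x → x + n ≋ x
  +n-≋ x = [m+n]%n≡m%n x n

  n+-≋ : ∀ x → n + x ≋ x
  n+-≋ x = %-remove-+ˡ x ∣-refl

  ≋-<⇒≡ : x < n → y < n → x ≋ y → x ≡ y
  ≋-<⇒≡ x<n y<n x≋y = trans (sym (m<n⇒m%n≡m x<n)) (trans x≋y (m<n⇒m%n≡m y<n))

  ∣∸⇒≋ : y ≤ x → n ∣ x ∸ y → x ≋ y
  ∣∸⇒≋ {y} y≤x n∣x∸y = trans (cong (_% n) (sym (m∸n+n≡m y≤x))) (%-remove-+ˡ y n∣x∸y)

  ≋⇒∣∸ : x ≋ y → n ∣ x ∸ y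
  ≋⇒∣∸ {x} {y} x≋y = divides (x / n ∸ y / n) (begin
    x ∸ y                                     ≡⟨ cong₂ _∸_ (m≡m%n+[m/n]*n x n) (m≡m%n+[m/n]*n y n) ⟩
    (x % n + x / n * n) ∸ (y % n + y / n * n) ≡⟨ cong (λ z → (x % n + x / n * n) ∸ (z + y / n * n)) x≋y ⟨
    (x % n + x / n * n) ∸ (x % n + y / n * n) ≡⟨ [m+n]∸[m+o]≡n∸o (x % n) _ _ ⟩
    x / n * n ∸ y / n * n                     ≡⟨ *-distribʳ-∸ n (x / n) (y / n) ⟨
    (x / n ∸ y / n) * n                       ∎)
    where open ≡-Reasoning

  ∣∣-∣⇒≋ : n ∣ ∣ x - y ∣ → x ≋ y
  ∣∣-∣⇒≋ {x} {y} n∣ with ≤-total y x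
  ... | inj₁ y≤x = ∣∸⇒≋ y≤x (subst (n ∣_) (m≤n⇒∣n-m∣≡n∸m y≤x) n∣)
  ... | inj₂ x≤y = sym (∣∸⇒≋ x≤y (subst (n ∣_) (m≤n⇒∣m-n∣≡n∸m x≤y) n∣))

  ≋⇒∣∣-∣ : x ≋ y → n ∣ ∣ x - y ∣
  ≋⇒∣∣-∣ {x} {y} x≋y with ∣m-n∣≡[m∸n]∨[n∸m] x y
  ... | inj₁ ∣x-y∣≡x∸y = subst (n ∣_) (sym ∣x-y∣≡x∸y) (≋⇒∣∸ x≋y)
  ... | inj₂ ∣x-y∣≡y∸x = subst (n ∣_) (sym ∣x-y∣≡y∸x) (≋⇒∣∸ (sym x≋y))

  -- Integer divisibility `+ n ∣ℤ z` is by definition `n ∣ ℤ.∣ z ∣`.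
  ∣ℤ⇒≋ : ℤ.+ n ∣ℤ ℤ.+ x ℤ.- ℤ.+ y → x ≋ y
  ∣ℤ⇒≋ {x} {y} n∣ = ∣∣-∣⇒≋ (subst (n ∣_) (∣[+m]-[+n]∣≡∣m-n∣ x y) n∣)

  ≋⇒∣ℤ : x ≋ y → ℤ.+ n ∣ℤ ℤ.+ x ℤ.- ℤ.+ y
  ≋⇒∣ℤ {x} {y} x≋y = subst (n ∣_) (sym (∣[+m]-[+n]∣≡∣m-n∣ x y)) (≋⇒∣∣-∣ x≋y)

  +-cancelˡ-≋ : ∀ c → c + x ≋ c + y → x ≋ y
  +-cancelˡ-≋ {x} {y} c c+x≋c+y =
    ∣∣-∣⇒≋ (subst (n ∣_) (∣m+n-m+o∣≡∣n-o∣ c x y) (≋⇒∣∣-∣ c+x≋c+y))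

  ≋-unwrap : x < n → y < n → d ≤ n → y ≋ x + d → y ≡ x + d ⊎ y + n ≡ x + d
  ≋-unwrap {x} {y} {d} x<n y<n d≤n y≋x+d with x + d <? n
  ... | yes x+d<n = inj₁ (≋-<⇒≡ y<n x+d<n y≋x+d)
  ... | no x+d≮n = inj₂ (trans (cong (_+ n) y≡x+d∸n) (m∸n+n≡m n≤x+d))
    where
    n≤x+d : n ≤ x + d
    n≤x+d = ≮⇒≥ x+d≮n
    x+d∸n<n : x + d ∸ n < n
    x+d∸n<n = +-cancelʳ-< n _ n
      (subst (_< n + n) (sym (m∸n+n≡m n≤x+d)) (+-mono-<-≤ x<n d≤n))
    y≡x+d∸n : y ≡ x + d ∸ n
    y≡x+d∸n = ≋-<⇒≡ y<n x+d∸n<n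
      (trans y≋x+d (trans (cong (_% n) (sym (m∸n+n≡m n≤x+d))) (+n-≋ _)))

module _ (n a : ℕ) .{{_ : NonZero n}} where
  open Congruence n

  Step : Fin n → Fin n → Set
  Step u w = toℕ w ≋ toℕ u + 1 ⊎ toℕ w ≋ toℕ u + a

  Arc[1,a]⇔Step : ∀ u w → Arc n (ℤ.+ 1 ∷ ℤ.+ a ∷ []) u w ⇔ Step u w
  Arc[1,a]⇔Step u w = mk⇔ to from
    where
    to : Arc n (ℤ.+ 1 ∷ ℤ.+ a ∷ []) u w → Step u w
    to (here n∣) = inj₁ (∣ℤ⇒≋ n∣)
    to (there (here n∣)) = inj₂ (∣ℤ⇒≋ n∣)
    from : Step u w → Arc n (ℤ.+ 1 ∷ ℤ.+ a ∷ []) u w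
    from (inj₁ w≋u+1) = here (≋⇒∣ℤ w≋u+1)
    from (inj₂ w≋u+a) = there (here (≋⇒∣ℤ w≋u+a))

  Arc[1,-c]⇔Step : ∀ c → c + a ≡ n → ∀ u w → Arc n (ℤ.+ 1 ∷ ℤ.- ℤ.+ c ∷ []) u w ⇔ Step u w
  Arc[1,-c]⇔Step c c+a≡n u w = mk⇔ to from
    where
    open ≋-Reasoning
    move-negation : ∀ (w u c : ℤ) → w ℤ.- (u ℤ.+ ℤ.- c) ≡ (w ℤ.+ c) ℤ.- u
    move-negation = solve-∀
    w+c≋u⇒w≋u+a : toℕ w + c ≋ toℕ u → toℕ w ≋ toℕ u + a
    w+c≋u⇒w≋u+a w+c≋u = begin
      toℕ w           ≈⟨ +n-≋ (toℕ w) ⟨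
      toℕ w + n       ≡⟨ cong (_+_ (toℕ w)) c+a≡n ⟨
      toℕ w + (c + a) ≡⟨ +-assoc (toℕ w) c a ⟨
      toℕ w + c + a   ≈⟨ +-cong-≋ w+c≋u refl ⟩
      toℕ u + a       ∎
    w≋u+a⇒w+c≋u : toℕ w ≋ toℕ u + a → toℕ w + c ≋ toℕ u
    w≋u+a⇒w+c≋u w≋u+a = begin
      toℕ w + c       ≈⟨ +-cong-≋ w≋u+a refl ⟩
      toℕ u + a + c   ≡⟨ +-assoc (toℕ u) a c ⟩
      toℕ u + (a + c) ≡⟨ cong (_+_ (toℕ u)) (trans (+-comm a c) c+a≡n) ⟩
      toℕ u + n       ≈⟨ +n-≋ (toℕ u) ⟩
      toℕ u           ∎
    to : Arc n (ℤ.+ 1 ∷ ℤ.- ℤ.+ c ∷ []) u w → Step u w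
    to (here n∣) = inj₁ (∣ℤ⇒≋ n∣)
    to (there (here n∣)) = inj₂ (w+c≋u⇒w≋u+a (∣ℤ⇒≋
      (subst (ℤ.+ n ∣ℤ_) (move-negation (ℤ.+ toℕ w) (ℤ.+ toℕ u) (ℤ.+ c)) n∣)))
    from : Step u w → Arc n (ℤ.+ 1 ∷ ℤ.- ℤ.+ c ∷ []) u w
    from (inj₁ w≋u+1) = here (≋⇒∣ℤ w≋u+1)
    from (inj₂ w≋u+a) = there (here (subst (ℤ.+ n ∣ℤ_)
      (sym (move-negation (ℤ.+ toℕ w) (ℤ.+ toℕ u) (ℤ.+ c))) (≋⇒∣ℤ (w≋u+a⇒w+c≋u w≋u+a))))

Dist≤Walk : ∀ {n bs u w k L} → Dist n bs u w k → Walk n bs L u w → k ≤ L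
Dist≤Walk (_ , minimal) walk = ≮⇒≥ (λ L<k → minimal _ L<k walk)

Dist>⇒Walk> : ∀ {n bs u w m} → (∀ k → Dist n bs u w k → m < k) →
              ∀ {L} → Walk n bs L u w → m < L
Dist>⇒Walk> {n} {bs} {u} {w} {m} dist> {L} = <-rec (λ L → Walk n bs L u w → m < L) bound L
  where
  bound : ∀ L → (∀ {j} → j < L → Walk n bs j u w → m < j) → Walk n bs L u w → m < L
  -- If m ≥ L the walk is itself shortest, since every shorter walk is longer than m.
  bound L shorter walk with m <? L
  ... | yes m<L = m<L
  ... | no m≮L = contradiction
    (dist> L (walk , λ j j<L walkⱼ → m≮L (<-trans (shorter j<L walkⱼ) j<L))) m≮L

sumUpTo : (ℕ → ℕ) → ℕ → ℕ
sumUpTo g zero    = 0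
sumUpTo g (suc m) = g 0 + sumUpTo (g ∘ suc) m

sumUpTo-+ : ∀ g m r → sumUpTo g (m + r) ≡ sumUpTo g m + sumUpTo (λ i → g (m + i)) r
sumUpTo-+ g zero    r = refl
sumUpTo-+ g (suc m) r =
  trans (cong (_+_ (g 0)) (sumUpTo-+ (g ∘ suc) m r)) (sym (+-assoc (g 0) _ _))

sumUpTo-cong : ∀ {g h} m → (∀ i → i < m → g i ≡ h i) → sumUpTo g m ≡ sumUpTo h m
sumUpTo-cong zero    _   = refl
sumUpTo-cong (suc m) g≡h = cong₂ _+_ (g≡h 0 z<s) (sumUpTo-cong m (λ i i<m → g≡h (suc i) (s<s i<m)))

sumUpTo-zero : ∀ {g} m → (∀ i → i < m → g i ≡ 0) → sumUpTo g m ≡ 0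
sumUpTo-zero zero    _   = refl
sumUpTo-zero (suc m) g≡0 = cong₂ _+_ (g≡0 0 z<s) (sumUpTo-zero m (λ i i<m → g≡0 (suc i) (s<s i<m)))

module FinSum = CommutativeMonoidSum +-0-commutativeMonoid

sum-tabulate : ∀ {m} (f : Fin m → ℕ) → sum (tabulate f) ≡ FinSum.sum f
sum-tabulate {zero}  f = refl
sum-tabulate {suc m} f = cong (_+_ (f Fin.zero)) (sum-tabulate (f ∘ Fin.suc))

sum-toℕ≡sumUpTo : ∀ m g → FinSum.sum {m} (g ∘ toℕ) ≡ sumUpTo g m
sum-toℕ≡sumUpTo zero    g = refl
sum-toℕ≡sumUpTo (suc m) g = cong (_+_ (g 0)) (sum-toℕ≡sumUpTo m (g ∘ suc))

cost-reindex : ∀ {n} (f : Fin n → ℕ) (g : ℕ → Fin n) (index : Fin n → ℕ) →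
               (∀ v → index v < n) → (∀ v → g (index v) ≡ v) →
               (∀ t → t < n → index (g t) ≡ t) → cost n f ≡ sumUpTo (f ∘ g) n
cost-reindex {n} f g index index<n g∘index index∘g = begin
  cost n f                     ≡⟨ sum-tabulate f ⟩
  FinSum.sum {n} f             ≡⟨ FinSum.sum-permute f π ⟩
  FinSum.sum {n} (f ∘ g ∘ toℕ) ≡⟨ sum-toℕ≡sumUpTo n (f ∘ g) ⟩
  sumUpTo (f ∘ g) n            ∎
  where
  open ≡-Reasoning
  π : Permutation n n
  π = permutation (g ∘ toℕ) (λ v → fromℕ< (index<n v))
    (λ v → trans (cong g (toℕ-fromℕ< (index<n v))) (g∘index v))
    (λ i → toℕ-injective (trans (toℕ-fromℕ< _) (index∘g (toℕ i) (toℕ<n i))))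

2*m≤n⇒m≤n/2 : ∀ m n → 2 * m ≤ n → m ≤ n / 2
2*m≤n⇒m≤n/2 m n 2m≤n =
  subst (_≤ n / 2) (m*n/n≡m m 2) (/-monoˡ-≤ 2 (subst (_≤ n) (*-comm 2 m) 2m≤n))

Spread : (ℕ → ℕ) → ℕ → Set
Spread g m = ∀ t → t < m → 0 < g t →
             ∀ s → 0 < s → s < 2 * g t → t + s < m × g (t + s) ≡ 0

Spread-shift : ∀ b → Spread g (b + r) → Spread (λ i → g (b + i)) r
Spread-shift {g} {r} b spread t t<r gbt>0 s s>0 s<2g
  with spread (b + t) (+-monoʳ-< b t<r) gbt>0 s s>0 s<2g
... | b+t+s<b+r , g≡0 =
  +-cancelˡ-< b _ _ (subst (_< b + r) (+-assoc b t s) b+t+s<b+r) ,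
  trans (cong g (sym (+-assoc b t s))) g≡0

Spread-block : Spread g (suc m) → g 0 ≡ suc k →
               2 * suc k ≤ suc m × sumUpTo g (2 * suc k) ≡ suc k
Spread-block {g} {m} {k} spread g0≡1+k = proj₁ (facts last 0<last ≤-refl) , block-sum
  where
  -- `2 * suc k` reduces to `suc last`: the block is position 0 followed by `last` silent ones.
  last = pred (2 * suc k)
  0<last : 0 < last
  0<last = <-≤-trans z<s (m≤n+m _ k)
  g0>0 : 0 < g 0
  g0>0 = subst (0 <_) (sym g0≡1+k) z<s
  facts : ∀ s → 0 < s → s ≤ last → s < suc m × g s ≡ 0
  facts s s>0 s≤last = spread 0 z<s g0>0 s s>0 (subst (λ c → s < 2 * c) (sym g0≡1+k) (s≤s s≤last))
  block-sum : sumUpTo g (2 * suc k) ≡ suc k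
  block-sum = begin
    g 0 + sumUpTo (g ∘ suc) last ≡⟨ cong₂ _+_ g0≡1+k
                                      (sumUpTo-zero last (λ i i<last → proj₂ (facts (suc i) z<s i<last))) ⟩
    suc k + 0                    ≡⟨ +-identityʳ (suc k) ⟩
    suc k                        ∎
    where open ≡-Reasoning

Spread⇒2*sum≤ : ∀ m g → Spread g m → 2 * sumUpTo g m ≤ m
Spread⇒2*sum≤ = <-rec _ bound
  where
  bound : ∀ m → (∀ {r} → r < m → ∀ g → Spread g r → 2 * sumUpTo g r ≤ r) →
          ∀ g → Spread g m → 2 * sumUpTo g m ≤ m
  bound zero    _   _ _      = z≤n
  bound (suc m) rec g spread = byFirst (g 0) refl
    where
    open ≤-Reasoning
    byFirst : ∀ k → g 0 ≡ k → 2 * sumUpTo g (suc m) ≤ suc m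
    byFirst zero g0≡0 = begin
      2 * sumUpTo g (suc m)   ≡⟨ cong (λ c → 2 * (c + sumUpTo (g ∘ suc) m)) g0≡0 ⟩
      2 * sumUpTo (g ∘ suc) m ≤⟨ rec ≤-refl (g ∘ suc) (Spread-shift 1 spread) ⟩
      m                       ≤⟨ n≤1+n m ⟩
      suc m                   ∎
    byFirst (suc k) g0≡1+k = begin
      2 * sumUpTo g (suc m)                   ≡⟨ cong (λ c → 2 * sumUpTo g c) split ⟩
      2 * sumUpTo g (width + rest)            ≡⟨ cong (2 *_) (sumUpTo-+ g width rest) ⟩
      2 * (sumUpTo g width + sumUpTo g′ rest) ≡⟨ cong (λ c → 2 * (c + sumUpTo g′ rest)) (proj₂ block) ⟩
      2 * (suc k + sumUpTo g′ rest)           ≡⟨ *-distribˡ-+ 2 (suc k) (sumUpTo g′ rest) ⟩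
      width + 2 * sumUpTo g′ rest             ≤⟨ +-monoʳ-≤ width (rec rest<1+m g′ spread′) ⟩
      width + rest                            ≡⟨ split ⟨
      suc m                                   ∎
      where
      width = 2 * suc k
      rest = suc m ∸ width
      g′ = λ i → g (width + i)
      block = Spread-block spread g0≡1+k
      split : suc m ≡ width + rest
      split = sym (m+[n∸m]≡n (proj₁ block))
      rest<1+m : rest < suc m
      rest<1+m = ∸-monoʳ-< z<s (proj₁ block)
      spread′ : Spread g′ rest
      spread′ = Spread-shift width (subst (Spread g) split spread)

jumpLength : ℕ → ℕ
jumpLength 0                   = 0
jumpLength 1                   = 1
jumpLength 2                   = 2
jumpLength (suc (suc (suc d))) = suc (jumpLength d)

d<2*k⇒jumpLength≤k : ∀ d k → d < 2 * k → jumpLength d ≤ k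
d<2*k⇒jumpLength≤k 0 k _ = z≤n
d<2*k⇒jumpLength≤k (suc d) 0 ()
d<2*k⇒jumpLength≤k 1 (suc k) _ = s≤s z≤n
d<2*k⇒jumpLength≤k 2 1 (s≤s (s≤s ()))
d<2*k⇒jumpLength≤k 2 (suc (suc k)) _ = s≤s (s≤s z≤n)
d<2*k⇒jumpLength≤k (suc (suc (suc d))) (suc k) d+3<2k+2 =
  s≤s (d<2*k⇒jumpLength≤k d k (<-trans (n<1+n d) (≤-pred (≤-pred (subst (4 + d ≤_) (*-suc 2 k) d+3<2k+2)))))

d+2≤3*k⇒jumpLength≤k : ∀ d k → 2 + d ≤ 3 * k → jumpLength d ≤ k
d+2≤3*k⇒jumpLength≤k 0 k _ = z≤n
d+2≤3*k⇒jumpLength≤k (suc d) 0 ()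
d+2≤3*k⇒jumpLength≤k 1 (suc k) _ = s≤s z≤n
d+2≤3*k⇒jumpLength≤k 2 1 (s≤s (s≤s (s≤s ())))
d+2≤3*k⇒jumpLength≤k 2 (suc (suc k)) _ = s≤s (s≤s z≤n)
d+2≤3*k⇒jumpLength≤k (suc (suc (suc d))) (suc k) d+5≤3k+3 =
  s≤s (d+2≤3*k⇒jumpLength≤k d k (≤-pred (≤-pred (≤-pred (subst (5 + d ≤_) (*-suc 3 k) d+5≤3k+3)))))

alternating : ℕ → ℕ
alternating 0             = 1
alternating 1             = 0
alternating (suc (suc x)) = alternating x

alternating≤1 : ∀ x → alternating x ≤ 1
alternating≤1 0             = s≤s z≤n
alternating≤1 1             = z≤n
alternating≤1 (suc (suc x)) = alternating≤1 x

alternating-+ : ∀ x d → alternating x ≡ 1 → alternating (x + d) ≡ alternating d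
alternating-+ 0             d _    = refl
alternating-+ (suc (suc x)) d altx = alternating-+ x d altx

alternating-*2 : ∀ e → alternating (e * 2) ≡ 1
alternating-*2 zero    = refl
alternating-*2 (suc e) = alternating-*2 e

sumUpTo-alternating : ∀ e → sumUpTo alternating (e * 2) ≡ e
sumUpTo-alternating zero    = refl
sumUpTo-alternating (suc e) = cong suc (sumUpTo-alternating e)

-- For odd n = 5 + 2e: the values 1, 0 repeated e times, then 2, 0, 0, 0, 0.
endHeavy : ℕ → ℕ → ℕ
endHeavy zero    zero          = 2
endHeavy zero    (suc _)       = 0
endHeavy (suc e) 0             = 1
endHeavy (suc e) 1             = 0
endHeavy (suc e) (suc (suc x)) = endHeavy e x

endHeavy≤2 : ∀ e x → endHeavy e x ≤ 2
endHeavy≤2 zero    zero          = ≤-refl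
endHeavy≤2 zero    (suc _)       = z≤n
endHeavy≤2 (suc e) 0             = s≤s z≤n
endHeavy≤2 (suc e) 1             = z≤n
endHeavy≤2 (suc e) (suc (suc x)) = endHeavy≤2 e x

endHeavy>0⇒ : ∀ e x → 0 < endHeavy e x → alternating x ≡ 1 × x ≤ e * 2
endHeavy>0⇒ zero    zero          _ = refl , z≤n
endHeavy>0⇒ (suc e) 0             _ = refl , z≤n
endHeavy>0⇒ (suc e) (suc (suc x)) h>0 with endHeavy>0⇒ e x h>0
... | altx , x≤2e = altx , s≤s (s≤s x≤2e)

endHeavy≡2⇒ : ∀ e x → endHeavy e x ≡ 2 → x ≡ e * 2
endHeavy≡2⇒ zero    zero          _   = refl
endHeavy≡2⇒ (suc e) (suc (suc x)) h≡2 = cong (suc ∘ suc) (endHeavy≡2⇒ e x h≡2)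

sumUpTo-endHeavy : ∀ e → sumUpTo (endHeavy e) (5 + e * 2) ≡ 2 + e
sumUpTo-endHeavy zero    = refl
sumUpTo-endHeavy (suc e) = cong suc (sumUpTo-endHeavy e)

module CirculantBroadcast
  (n a : ℕ) .{{_ : NonZero n}} (n+1≡3a : suc n ≡ 3 * a) (6≤n : 6 ≤ n)
  (bs : List ℤ) (Arc⇔Step : ∀ u w → Arc n bs u w ⇔ Step n a u w) where

  open Congruence n

  0<n : 0 < n
  0<n = <-≤-trans z<s 6≤n

  ≤6⇒≤n : d ≤ 6 → d ≤ n
  ≤6⇒≤n d≤6 = ≤-trans d≤6 6≤n

  2a≤n : 2 * a ≤ n
  2a≤n = ≤-pred (begin
    suc (2 * a) ≡⟨ +-comm 1 (2 * a) ⟩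
    2 * a + 1   ≤⟨ +-monoʳ-≤ (2 * a) 1≤a ⟩
    2 * a + a   ≡⟨ +-comm (2 * a) a ⟩
    3 * a       ≡⟨ n+1≡3a ⟨
    suc n       ∎)
    where
    open ≤-Reasoning
    1≤a : 1 ≤ a
    1≤a = n≢0⇒n>0 (λ a≡0 → 0≢1+n (sym (trans n+1≡3a (cong (3 *_) a≡0))))

  3a≋1 : 3 * a ≋ 1
  3a≋1 = trans (cong (_% n) (sym n+1≡3a)) (+n-≋ 1)

  vertex : ℕ → Fin n
  vertex x = x mod n

  vertex-≋ : ∀ x → toℕ (vertex x) ≋ x
  vertex-≋ x = trans (cong (_% n) (toℕ-fromℕ< (m%n<n x n))) (%-≋ x)

  coord : Fin n → ℕ
  coord v = 3 * toℕ v

  coord-injective : ∀ {u w} → coord u ≋ coord w → u ≡ w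
  coord-injective {u} {w} coordu≋coordw =
    toℕ-injective (≋-<⇒≡ (toℕ<n u) (toℕ<n w) (begin
      toℕ u       ≈⟨ a*coord≋ u ⟨
      a * coord u ≈⟨ *-cong-≋ {a} refl coordu≋coordw ⟩
      a * coord w ≈⟨ a*coord≋ w ⟩
      toℕ w       ∎))
    where
    open ≋-Reasoning
    a*coord≋ : ∀ v → a * coord v ≋ toℕ v
    a*coord≋ v = begin
      a * (3 * toℕ v) ≡⟨ *-assoc a 3 (toℕ v) ⟨
      a * 3 * toℕ v   ≡⟨ cong (_* toℕ v) (*-comm a 3) ⟩
      3 * a * toℕ v   ≈⟨ *-cong-≋ 3a≋1 refl ⟩
      1 * toℕ v       ≡⟨ *-identityˡ (toℕ v) ⟩
      toℕ v           ∎

  +1⇒coord+3 : ∀ {u w} → toℕ w ≋ toℕ u + 1 → coord w ≋ coord u + 3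
  +1⇒coord+3 {u} {w} w≋u+1 = begin
    3 * toℕ w       ≈⟨ *-cong-≋ {3} refl w≋u+1 ⟩
    3 * (toℕ u + 1) ≡⟨ *-distribˡ-+ 3 (toℕ u) 1 ⟩
    coord u + 3     ∎
    where open ≋-Reasoning

  +a⇒coord+1 : ∀ {u w} → toℕ w ≋ toℕ u + a → coord w ≋ coord u + 1
  +a⇒coord+1 {u} {w} w≋u+a = begin
    3 * toℕ w       ≈⟨ *-cong-≋ {3} refl w≋u+a ⟩
    3 * (toℕ u + a) ≡⟨ *-distribˡ-+ 3 (toℕ u) a ⟩
    coord u + 3 * a ≈⟨ +-cong-≋ {coord u} refl 3a≋1 ⟩
    coord u + 1     ∎
    where open ≋-Reasoning

  Arc⇒coord : ∀ {u w} → Arc n bs u w → coord w ≋ coord u + 3 ⊎ coord w ≋ coord u + 1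
  Arc⇒coord {u} {w} = Sum.map +1⇒coord+3 +a⇒coord+1 ∘ Equivalence.to (Arc⇔Step u w)

  hop₃ hop₁ : Fin n → Fin n
  hop₃ u = vertex (toℕ u + 1)
  hop₁ u = vertex (toℕ u + a)

  arc-hop₃ : ∀ u → Arc n bs u (hop₃ u)
  arc-hop₃ u = Equivalence.from (Arc⇔Step u (hop₃ u)) (inj₁ (vertex-≋ _))

  arc-hop₁ : ∀ u → Arc n bs u (hop₁ u)
  arc-hop₁ u = Equivalence.from (Arc⇔Step u (hop₁ u)) (inj₂ (vertex-≋ _))

  jump : ℕ → Fin n → Fin n
  jump 0                   u = u
  jump 1                   u = hop₁ u
  jump 2                   u = hop₁ (hop₁ u)
  jump (suc (suc (suc d))) u = jump d (hop₃ u)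

  jump-walk : ∀ d u → Walk n bs (jumpLength d) u (jump d u)
  jump-walk 0                   u = here
  jump-walk 1                   u = step (arc-hop₁ u) here
  jump-walk 2                   u = step (arc-hop₁ u) (step (arc-hop₁ (hop₁ u)) here)
  jump-walk (suc (suc (suc d))) u = step (arc-hop₃ u) (jump-walk d (hop₃ u))

  coord-jump : ∀ d u → coord (jump d u) ≋ coord u + d
  coord-jump 0                   u = ≋-reflexive (sym (+-identityʳ (coord u)))
  coord-jump 1                   u = +a⇒coord+1 (vertex-≋ _)
  coord-jump 2                   u = begin
    coord (hop₁ (hop₁ u)) ≈⟨ +a⇒coord+1 (vertex-≋ _) ⟩
    coord (hop₁ u) + 1    ≈⟨ +-cong-≋ (+a⇒coord+1 (vertex-≋ _)) refl ⟩
    coord u + 1 + 1       ≡⟨ +-assoc (coord u) 1 1 ⟩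
    coord u + 2           ∎
    where open ≋-Reasoning
  coord-jump (suc (suc (suc d))) u = begin
    coord (jump d (hop₃ u)) ≈⟨ coord-jump d (hop₃ u) ⟩
    coord (hop₃ u) + d      ≈⟨ +-cong-≋ (+1⇒coord+3 (vertex-≋ _)) refl ⟩
    coord u + 3 + d         ≡⟨ +-assoc (coord u) 3 d ⟩
    coord u + (3 + d)       ∎
    where open ≋-Reasoning

  Walk⇒coord : ∀ {L u w} → Walk n bs L u w →
               ∃₂ λ i j → L ≡ i + j × coord w ≋ coord u + (i * 3 + j)
  Walk⇒coord here = 0 , 0 , refl , ≋-reflexive (sym (+-identityʳ _))
  Walk⇒coord {u = u} {w} (step {v = v} arc walk) with Walk⇒coord walk | Arc⇒coord arc
  ... | i , j , L≡i+j , w≋v+ | inj₁ v≋u+3 = suc i , j , cong suc L≡i+j , (begin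
    coord w                   ≈⟨ w≋v+ ⟩
    coord v + (i * 3 + j)     ≈⟨ +-cong-≋ v≋u+3 refl ⟩
    coord u + 3 + (i * 3 + j) ≡⟨ +-assoc (coord u) 3 _ ⟩
    coord u + (suc i * 3 + j) ∎)
    where open ≋-Reasoning
  ... | i , j , L≡i+j , w≋v+ | inj₂ v≋u+1 = i , suc j , trans (cong suc L≡i+j) (sym (+-suc i j)) , (begin
    coord w                   ≈⟨ w≋v+ ⟩
    coord v + (i * 3 + j)     ≈⟨ +-cong-≋ v≋u+1 refl ⟩
    coord u + 1 + (i * 3 + j) ≡⟨ +-assoc (coord u) 1 _ ⟩
    coord u + suc (i * 3 + j) ≡⟨ cong (_+_ (coord u)) (+-suc (i * 3) j) ⟨
    coord u + (i * 3 + suc j) ∎)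
    where open ≋-Reasoning

  jump-+ : ∀ t s u → jump (t + s) u ≡ jump s (jump t u)
  jump-+ t s u = coord-injective (begin
    coord (jump (t + s) u)    ≈⟨ coord-jump (t + s) u ⟩
    coord u + (t + s)         ≡⟨ +-assoc (coord u) t s ⟨
    coord u + t + s           ≈⟨ +-cong-≋ (coord-jump t u) refl ⟨
    coord (jump t u) + s      ≈⟨ coord-jump s (jump t u) ⟨
    coord (jump s (jump t u)) ∎)
    where open ≋-Reasoning

  jump-n : ∀ u → jump n u ≡ u
  jump-n u = coord-injective (trans (coord-jump n u) (+n-≋ (coord u)))

  offset : Fin n → Fin n → ℕ
  offset u v = (n ∸ coord u % n + coord v) % n

  coord-offset : ∀ u v → coord u + offset u v ≋ coord v
  coord-offset u v = begin
    coord u + offset u v                      ≈⟨ +-cong-≋ (sym (%-≋ (coord u))) (%-≋ _) ⟩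
    coord u % n + (n ∸ coord u % n + coord v) ≡⟨ +-assoc (coord u % n) _ (coord v) ⟨
    coord u % n + (n ∸ coord u % n) + coord v ≡⟨ cong (_+ coord v) (m+[n∸m]≡n (m%n≤n (coord u) n)) ⟩
    n + coord v                               ≈⟨ n+-≋ (coord v) ⟩
    coord v                                   ∎
    where open ≋-Reasoning

  jump-offset : ∀ u v → jump (offset u v) u ≡ v
  jump-offset u v = coord-injective (trans (coord-jump (offset u v) u) (coord-offset u v))

  offset-jump : ∀ {u t} → t < n → offset u (jump t u) ≡ t
  offset-jump {u} {t} t<n = ≋-<⇒≡ (m%n<n _ n) t<n
    (+-cancelˡ-≋ (coord u) (trans (coord-offset u (jump t u)) (coord-jump t u)))

  jump-injective : ∀ {u t t′} → t < n → t′ < n → jump t u ≡ jump t′ u → t ≡ t′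
  jump-injective {u} t<n t′<n jt≡jt′ =
    trans (sym (offset-jump t<n)) (trans (cong (offset u) jt≡jt′) (offset-jump t′<n))

  cost≡sumUpTo-jump : ∀ u f → cost n f ≡ sumUpTo (λ t → f (jump t u)) n
  cost≡sumUpTo-jump u f =
    cost-reindex f (λ t → jump t u) (offset u) (λ _ → m%n<n _ n) (jump-offset u) (λ _ → offset-jump)

  LeEcc⇒≤a : ∀ {v m} → LeEcc n bs v m → m ≤ a
  LeEcc⇒≤a {v} (u , k , dist , m≤k) =
    ≤-trans m≤k (≤-trans (Dist≤Walk dist walk) (d+2≤3*k⇒jumpLength≤k (offset v u) a offset+2≤3a))
    where
    walk : Walk n bs (jumpLength (offset v u)) v u
    walk = subst (Walk n bs _ v) (jump-offset v u) (jump-walk (offset v u) v)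
    offset+2≤3a : 2 + offset v u ≤ 3 * a
    offset+2≤3a = subst (2 + offset v u ≤_) n+1≡3a (s≤s (m%n<n _ n))

  Dist-jump2 : ∀ v → Dist n bs v (jump 2 v) 2
  Dist-jump2 v = jump-walk 2 v , shorter
    where
    small-≋⇒≡ : x < 6 → y < 6 → x ≋ y → x ≡ y
    small-≋⇒≡ x<6 y<6 = ≋-<⇒≡ (<-≤-trans x<6 6≤n) (<-≤-trans y<6 6≤n)
    short-offset≢2 : ∀ i j → i + j < 2 → ¬ (2 ≋ i * 3 + j)
    short-offset≢2 0 0 _ 2≋0 with small-≋⇒≡ (s<s (s<s z<s)) z<s 2≋0
    ... | ()
    short-offset≢2 0 1 _ 2≋1 with small-≋⇒≡ (s<s (s<s z<s)) (s<s z<s) 2≋1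
    ... | ()
    short-offset≢2 1 0 _ 2≋3 with small-≋⇒≡ (s<s (s<s z<s)) (s<s (s<s (s<s z<s))) 2≋3
    ... | ()
    short-offset≢2 0 (suc (suc j)) (s≤s (s≤s ()))
    short-offset≢2 1 (suc j)       (s≤s (s≤s ()))
    short-offset≢2 (suc (suc i)) j (s≤s (s≤s ()))
    shorter : ∀ L → L < 2 → ¬ Walk n bs L v (jump 2 v)
    shorter L L<2 walk with Walk⇒coord walk
    ... | i , j , refl , j2≋v+ = short-offset≢2 i j L<2 (+-cancelˡ-≋ (coord v) (begin
      coord v + 2           ≈⟨ coord-jump 2 v ⟨
      coord (jump 2 v)      ≈⟨ j2≋v+ ⟩
      coord v + (i * 3 + j) ∎))
      where open ≋-Reasoning

  ≤2⇒LeEcc : ∀ v {m} → m ≤ 2 → LeEcc n bs v m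
  ≤2⇒LeEcc v m≤2 = jump 2 v , 2 , Dist-jump2 v , m≤2

  module _ {f : Fin n → ℕ} (broadcast : IndependentBroadcast n bs f) where

    strength≤a : ∀ v → f v ≤ a
    strength≤a v = LeEcc⇒≤a (proj₁ (proj₂ broadcast) v)

    silent : ∀ {A} s → 0 < f A → s < 2 * f A → A ≢ jump s A → f (jump s A) ≡ 0
    silent {A} s fA>0 s<2fA A≢B = n≤0⇒n≡0 (≮⇒≥ λ fB>0 →
      <⇒≱ (Dist>⇒Walk> (proj₂ (proj₂ broadcast) A _ A≢B fA>0 fB>0) (jump-walk s A))
          (d<2*k⇒jumpLength≤k s (f A) s<2fA))

    spread : ∀ u → (∀ v → 0 < f v → 0 < f u) → Spread (λ t → f (jump t u)) n
    spread u u-broadcasts t t<n fA>0 s s>0 s<2fA = t+s<n , silent-t+s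
      where
      A = jump t u
      back-to-u : jump (n ∸ t) A ≡ u
      back-to-u = begin
        jump (n ∸ t) (jump t u) ≡⟨ jump-+ t (n ∸ t) u ⟨
        jump (t + (n ∸ t)) u    ≡⟨ cong (λ c → jump c u) (m+[n∸m]≡n (<⇒≤ t<n)) ⟩
        jump n u                ≡⟨ jump-n u ⟩
        u                       ∎
        where open ≡-Reasoning
      -- A block running past the end of the cycle would silence u itself, unless A = u,
      -- and then it would cover the whole cycle although 2 f(A) ≤ 2a ≤ n.
      no-wrap : ¬ (n ≤ t + s)
      no-wrap n≤t+s = >⇒≢ (u-broadcasts A fA>0)
        (subst (λ B → f B ≡ 0) back-to-u (silent (n ∸ t) fA>0 (≤-<-trans n∸t≤s s<2fA) A≢u))
        where
        n∸t≤s : n ∸ t ≤ s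
        n∸t≤s = subst (n ∸ t ≤_) (m+n∸m≡n t s) (∸-monoˡ-≤ t n≤t+s)
        A≢u : A ≢ jump (n ∸ t) A
        A≢u A≡u = <⇒≱ s<2fA (begin
          2 * f A ≤⟨ *-monoʳ-≤ 2 (strength≤a A) ⟩
          2 * a   ≤⟨ 2a≤n ⟩
          n       ≡⟨ cong (n ∸_) t≡0 ⟨
          n ∸ t   ≤⟨ n∸t≤s ⟩
          s       ∎)
          where
          open ≤-Reasoning
          t≡0 : t ≡ 0
          t≡0 = jump-injective t<n 0<n (trans A≡u back-to-u)
      t+s<n : t + s < n
      t+s<n = ≰⇒> no-wrap
      silent-t+s : f (jump (t + s) u) ≡ 0
      silent-t+s = subst (λ B → f B ≡ 0) (sym (jump-+ t s u)) (silent s fA>0 s<2fA A≢B)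
        where
        A≢B : A ≢ jump s A
        A≢B A≡B = >⇒≢ s>0 (+-cancelˡ-≡ t s 0 (trans (sym t≡t+s) (sym (+-identityʳ t))))
          where
          t≡t+s : t ≡ t + s
          t≡t+s = jump-injective t<n t+s<n (trans A≡B (sym (jump-+ t s u)))

    cost≤n/2-from : ∀ u → (∀ v → 0 < f v → 0 < f u) → cost n f ≤ n / 2
    cost≤n/2-from u u-broadcasts = 2*m≤n⇒m≤n/2 (cost n f) n
      (subst (λ c → 2 * c ≤ n) (sym (cost≡sumUpTo-jump u f))
        (Spread⇒2*sum≤ n _ (spread u u-broadcasts)))

    cost≤n/2 : cost n f ≤ n / 2
    cost≤n/2 with any? (λ v → 0 <? f v)
    ... | yes (u , fu>0) = cost≤n/2-from u (λ _ _ → fu>0)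
    ... | no nobody      = cost≤n/2-from (vertex 0) (λ v fv>0 → ⊥-elim (nobody (v , fv>0)))

  Sparse : (ℕ → ℕ) → Set
  Sparse h = ∀ {x y} → x < n → y < n → x ≢ y → 0 < h x → 0 < h y →
             ∀ i j → i + j ≤ h x → ¬ (y ≋ x + (i * 3 + j))

  module _ (h : ℕ → ℕ) (h≤2 : ∀ x → h x ≤ 2) (sparse : Sparse h) where

    patternBroadcast : Fin n → ℕ
    patternBroadcast v = h (coord v % n)

    patternBroadcast-independent : IndependentBroadcast n bs patternBroadcast
    patternBroadcast-independent =
      (λ v → v , ≤2⇒LeEcc v (h≤2 _)) , (λ v → ≤2⇒LeEcc v (h≤2 _)) , separated
      where
      separated : ∀ u w → u ≢ w → 0 < patternBroadcast u → 0 < patternBroadcast w →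
                  ∀ k → Dist n bs u w k → patternBroadcast u < k
      separated u w u≢w hu>0 hw>0 k (walk , _) with Walk⇒coord walk
      ... | i , j , k≡i+j , w≋u+ = ≰⇒> λ k≤hu →
        sparse (m%n<n _ n) (m%n<n _ n) (u≢w ∘ coord-injective) hu>0 hw>0 i j
          (subst (_≤ patternBroadcast u) k≡i+j k≤hu)
          (trans (%-≋ (coord w)) (trans w≋u+ (+-cong-≋ (sym (%-≋ (coord u))) refl)))

    cost-patternBroadcast : cost n patternBroadcast ≡ sumUpTo h n
    cost-patternBroadcast = trans (cost≡sumUpTo-jump (vertex 0) patternBroadcast) (sumUpTo-cong n at)
      where
      at : ∀ t → t < n → patternBroadcast (jump t (vertex 0)) ≡ h t
      at t t<n = cong h (trans (coord-jump t (vertex 0))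
        (trans (+-cong-≋ (*-cong-≋ {3} refl (vertex-≋ 0)) refl) (m<n⇒m%n≡m t<n)))

    patternBroadcast-witness : ∀ {c} → sumUpTo h n ≡ c → ∃[ f ] (IndependentBroadcast n bs f × cost n f ≡ c)
    patternBroadcast-witness sum≡c = patternBroadcast , patternBroadcast-independent , trans cost-patternBroadcast sum≡c

  same-position : x < n → y < n → x ≢ y → ¬ (y ≋ x + 0)
  same-position {x} {y} x<n y<n x≢y y≋x+0 =
    x≢y (≋-<⇒≡ x<n y<n (sym (trans y≋x+0 (cong (_% n) (+-identityʳ x)))))

  odd-offset-wraps : alternating x ≡ 1 → alternating y ≡ 1 → alternating d ≡ 0 →
                     x < n → y < n → d ≤ n → y ≋ x + d → y + n ≡ x + d
  odd-offset-wraps {x} {y} {d} altx alty altd x<n y<n d≤n y≋x+d with ≋-unwrap x<n y<n d≤n y≋x+d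
  ... | inj₂ wrapped = wrapped
  ... | inj₁ y≡x+d = contradiction
    (trans (sym alty) (trans (cong alternating y≡x+d) (trans (alternating-+ x d altx) altd)))
    (λ ())

  alternating-sparse : alternating n ≡ 1 → Sparse alternating
  alternating-sparse altn {x} {y} x<n y<n x≢y hx>0 hy>0 i j i+j≤hx =
    offsets i j (≤-trans i+j≤hx (alternating≤1 x))
    where
    altx = ≤-antisym (alternating≤1 x) hx>0
    alty = ≤-antisym (alternating≤1 y) hy>0
    odd-offset : ∀ d → alternating d ≡ 0 → d ≤ 6 → ¬ (y ≋ x + d)
    odd-offset d altd d≤6 y≋x+d = contradiction (begin
      1                      ≡⟨ altn ⟨
      alternating n          ≡⟨ alternating-+ y n alty ⟨
      alternating (y + n)    ≡⟨ cong alternating (odd-offset-wraps altx alty altd x<n y<n (≤6⇒≤n d≤6) y≋x+d) ⟩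
      alternating (x + d)    ≡⟨ alternating-+ x d altx ⟩
      alternating d          ≡⟨ altd ⟩
      0                      ∎) (λ ())
      where open ≡-Reasoning
    offsets : ∀ i j → i + j ≤ 1 → ¬ (y ≋ x + (i * 3 + j))
    offsets 0 0 _ = same-position x<n y<n x≢y
    offsets 0 1 _ = odd-offset 1 refl (s≤s z≤n)
    offsets 1 0 _ = odd-offset 3 refl (s≤s (s≤s (s≤s z≤n)))
    offsets 0 (suc (suc j)) (s≤s ())
    offsets 1 (suc j)       (s≤s ())
    offsets (suc (suc i)) j (s≤s ())

  endHeavy-sparse : ∀ e → n ≡ 5 + e * 2 → Sparse (endHeavy e)
  endHeavy-sparse e n≡5+2e {x} {y} x<n y<n x≢y hx>0 hy>0 i j i+j≤hx =
    offsets i j (≤-trans i+j≤hx (endHeavy≤2 e x)) i+j≤hx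
    where
    altx = proj₁ (endHeavy>0⇒ e x hx>0)
    alty = proj₁ (endHeavy>0⇒ e y hy>0)
    x≤2e = proj₂ (endHeavy>0⇒ e x hx>0)
    y≤2e = proj₂ (endHeavy>0⇒ e y hy>0)
    short-offsets-stay : d ≤ 4 → y + n ≢ x + d
    short-offsets-stay {d} d≤4 wrapped = <⇒≢ (begin-strict
      x + d     ≤⟨ +-mono-≤ x≤2e d≤4 ⟩
      e * 2 + 4 ≡⟨ +-comm (e * 2) 4 ⟩
      4 + e * 2 <⟨ n<1+n _ ⟩
      5 + e * 2 ≡⟨ n≡5+2e ⟨
      n         ≤⟨ m≤n+m n y ⟩
      y + n     ∎) (sym wrapped)
      where open ≤-Reasoning
    one-arc : ∀ d → alternating d ≡ 0 → d ≤ 3 → ¬ (y ≋ x + d)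
    one-arc d altd d≤3 y≋x+d = short-offsets-stay (m≤n⇒m≤1+n d≤3)
      (odd-offset-wraps altx alty altd x<n y<n (≤6⇒≤n (≤-trans d≤3 (m≤m+n 3 3))) y≋x+d)
    ≤4∨≡6⇒≤n : d ≤ 4 ⊎ d ≡ 6 → d ≤ n
    ≤4∨≡6⇒≤n = ≤6⇒≤n ∘ [ (λ d≤4 → ≤-trans d≤4 (m≤m+n 4 2)) , ≤-reflexive ]
    two-arcs : endHeavy e x ≡ 2 → ∀ d → 0 < d → d ≤ 4 ⊎ d ≡ 6 → ¬ (y ≋ x + d)
    two-arcs hx≡2 d d>0 d≤4∨d≡6 y≋x+d with ≋-unwrap x<n y<n (≤4∨≡6⇒≤n d≤4∨d≡6) y≋x+d | d≤4∨d≡6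
    ... | inj₁ y≡x+d | _ = <⇒≱ (m<m+n x d>0) (begin
      x + d ≡⟨ y≡x+d ⟨
      y     ≤⟨ y≤2e ⟩
      e * 2 ≡⟨ endHeavy≡2⇒ e x hx≡2 ⟨
      x     ∎)
      where open ≤-Reasoning
    ... | inj₂ wrapped | inj₁ d≤4 = short-offsets-stay d≤4 wrapped
    ... | inj₂ wrapped | inj₂ refl = contradiction (cong alternating y≡1) (λ eq → 0≢1+n (trans (sym eq) alty))
      where
      y≡1 : y ≡ 1
      y≡1 = +-cancelʳ-≡ n y 1 (begin
        y + n         ≡⟨ wrapped ⟩
        x + 6         ≡⟨ cong (_+ 6) (endHeavy≡2⇒ e x hx≡2) ⟩
        e * 2 + 6     ≡⟨ +-comm (e * 2) 6 ⟩
        1 + (5 + e * 2) ≡⟨ cong suc n≡5+2e ⟨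
        1 + n         ∎)
        where open ≡-Reasoning
    offsets : ∀ i j → i + j ≤ 2 → i + j ≤ endHeavy e x → ¬ (y ≋ x + (i * 3 + j))
    offsets 0 0 _ _ = same-position x<n y<n x≢y
    offsets 0 1 _ _ = one-arc 1 refl (s≤s z≤n)
    offsets 1 0 _ _ = one-arc 3 refl ≤-refl
    offsets 0 2 _ 2≤hx = two-arcs (≤-antisym (endHeavy≤2 e x) 2≤hx) 2 z<s (inj₁ (s≤s (s≤s z≤n)))
    offsets 1 1 _ 2≤hx = two-arcs (≤-antisym (endHeavy≤2 e x) 2≤hx) 4 z<s (inj₁ ≤-refl)
    offsets 2 0 _ 2≤hx = two-arcs (≤-antisym (endHeavy≤2 e x) 2≤hx) 6 z<s (inj₂ refl)
    offsets 0 (suc (suc (suc j))) (s≤s (s≤s ())) _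
    offsets 1 (suc (suc j))       (s≤s (s≤s ())) _
    offsets 2 (suc j)             (s≤s (s≤s ())) _
    offsets (suc (suc (suc i))) j (s≤s (s≤s ())) _

  broadcast-of-cost : ∀ r e → n ≡ r + e * 2 → r < 2 →
                    ∃[ f ] (IndependentBroadcast n bs f × cost n f ≡ e)
  broadcast-of-cost 0 e n≡2e _ =
    patternBroadcast-witness alternating (λ x → m≤n⇒m≤1+n (alternating≤1 x)) (alternating-sparse altn)
      (trans (cong (sumUpTo alternating) n≡2e) (sumUpTo-alternating e))
    where
    altn : alternating n ≡ 1
    altn = trans (cong alternating n≡2e) (alternating-*2 e)
  broadcast-of-cost 1 (suc (suc e)) n≡5+2e _ =
    patternBroadcast-witness (endHeavy e) (endHeavy≤2 e) (endHeavy-sparse e n≡5+2e)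
      (trans (cong (sumUpTo (endHeavy e)) n≡5+2e) (sumUpTo-endHeavy e))
  broadcast-of-cost 1 0 n≡1 _ = contradiction (subst (6 ≤_) n≡1 6≤n) (λ { (s≤s ()) })
  broadcast-of-cost 1 1 n≡3 _ = contradiction (subst (6 ≤_) n≡3 6≤n) (λ { (s≤s (s≤s (s≤s ()))) })
  broadcast-of-cost (suc (suc _)) _ _ (s≤s (s≤s ()))

  broadcastIndependenceNumber : BroadcastIndependenceNumber n bs (n / 2)
  broadcastIndependenceNumber =
    broadcast-of-cost (n % 2) (n / 2) (m≡m%n+[m/n]*n n 2) (m%n<n n 2) , λ _ → cost≤n/2

theorem4 : (n a : ℕ) → n ≡ 3 * a ∸ 1 → 4 ≤ a →
    BroadcastIndependenceNumber n (+ 1 ∷ + a ∷ []) (n / 2) ×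
    BroadcastIndependenceNumber n (+ 1 ∷ - (+ (2 * a ∸ 1)) ∷ []) (n / 2)
theorem4 n a n≡3a∸1 4≤a =
  Broadcast.broadcastIndependenceNumber _ (Arc[1,a]⇔Step n a) ,
  Broadcast.broadcastIndependenceNumber _ (Arc[1,-c]⇔Step n a (2 * a ∸ 1) 2a∸1+a≡n)
  where
  12≤3a : 12 ≤ 3 * a
  12≤3a = *-monoʳ-≤ 3 4≤a
  n+1≡3a : suc n ≡ 3 * a
  n+1≡3a = trans (cong suc n≡3a∸1) (m+[n∸m]≡n (≤-trans (s≤s z≤n) 12≤3a))
  6≤n : 6 ≤ n
  6≤n = ≤-pred (≤-trans (m≤m+n 7 5) (subst (12 ≤_) (sym n+1≡3a) 12≤3a))
  instance
    n≢0 : NonZero n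
    n≢0 = >-nonZero (<-≤-trans z<s 6≤n)
  2a∸1+a≡n : 2 * a ∸ 1 + a ≡ n
  2a∸1+a≡n = suc-injective (begin
    suc (2 * a ∸ 1) + a ≡⟨ cong (_+ a) (m+[n∸m]≡n (≤-trans (s≤s z≤n) (*-monoʳ-≤ 2 4≤a))) ⟩
    2 * a + a           ≡⟨ +-comm (2 * a) a ⟩
    3 * a               ≡⟨ n+1≡3a ⟨
    suc n               ∎)
    where open ≡-Reasoning
  module Broadcast = CirculantBroadcast n a n+1≡3a 6≤n
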